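{- Every cubic (3-regular) finite simple graph $G$ has a good half-edge coloring.
   Context: For a graph $G$, $G^{\frac{1}{2}}$ is obtained by subdividing each edge once. Each edge $uv$ of $G$ thus corresponds to two edges of $G^{\frac{1}{2}}$, called half-edges: $e_{uv}$ (incident with $u$) and $e_{vu}$ (incident with $v$). For a cubic graph $G$, a (proper) half-edge coloring is a map $h:E(G^{\frac{1}{2}})\to\{1,2,3\}$ that is a proper edge coloring of $G^{\frac{1}{2}}$ (half-edges sharing an endpoint in $G^{\frac{1}{2}}$ get different colors). A cycle in $G$ is a bad cycle for $h$ if the half-edges of its edges use only two of the three colors. $h$ is a good half-edge coloring if there is no bad cycle. -}

module Defs where

open import Data.Nat using (ℕ; suc; _+_)
open import Data.Bool using (Bool; true; false; T)
open import Data.Fin using (Fin; zero; suc; inject₁; fromℕ)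
open import Data.List using (length; filter)
open import Data.List using () renaming (allFin to allFinL)
open import Data.Product using (Σ; ∃; _×_; _,_)
open import Data.Sum using (_⊎_)
open import Relation.Binary.PropositionalEquality using (_≡_; _≢_)
open import Relation.Nullary using (¬_)
open import Relation.Nullary.Decidable using (T?)
open import Function.Definitions using (Injective)

record Graph (n : ℕ) : Set where
  field
    adj     : Fin n → Fin n → Bool
    symm    : ∀ u v → adj u v ≡ adj v u
    irrefl  : ∀ v → adj v v ≡ false

open Graph public

Adj : ∀ {n} → Graph n → Fin n → Fin n → Set
Adj G u v = T (adj G u v)

degree : ∀ {n} → Graph n → Fin n → ℕ
degree {n} G v = length (filter (λ w → T? (adj G v w)) (allFinL n))

Cubic : ∀ {n} → Graph n → Set
Cubic G = ∀ v → degree G v ≡ 3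

-- A half-edge assignment: h u v is the colour of the half-edge e_uv
-- (the half of edge uv incident with u); only meaningful when u ~ v.
HalfEdgeAssignment : ℕ → Set
HalfEdgeAssignment n = Fin n → Fin n → Fin 3

-- Proper edge colouring of G^{1/2}:
--  * at an original vertex u, the half-edges e_uv, e_uw (v ≠ w neighbours of u)
--    get different colours;
--  * at the subdivision vertex of uv, the half-edges e_uv and e_vu differ.
ProperHalfEdgeColoring : ∀ {n} → Graph n → HalfEdgeAssignment n → Set
ProperHalfEdgeColoring G h =
  (∀ u v w → Adj G u v → Adj G u w → v ≢ w → h u v ≢ h u w) ×
  (∀ u v → Adj G u v → h u v ≢ h v u)

record Cycle {n : ℕ} (G : Graph n) : Set where
  field
    k        : ℕ
    vs       : Fin (3 + k) → Fin n
    distinct : Injective _≡_ _≡_ vs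
    step     : ∀ (i : Fin (2 + k)) → Adj G (vs (inject₁ i)) (vs (suc i))
    close    : Adj G (vs (fromℕ (2 + k))) (vs zero)

open Cycle public

CycleEdge : ∀ {n} {G : Graph n} → Cycle G → Fin n → Fin n → Set
CycleEdge C u v =
  (∃ λ i → u ≡ vs C (inject₁ i) × v ≡ vs C (suc i)) ⊎
  (u ≡ vs C (fromℕ (2 + k C)) × v ≡ vs C zero)

-- C is bad for h if the half-edges of its edges use only two of the three
-- colours, i.e. some colour c appears on none of them.
BadCycle : ∀ {n} {G : Graph n} → HalfEdgeAssignment n → Cycle G → Set
BadCycle h C = ∃ λ (c : Fin 3) →
  ∀ u v → CycleEdge C u v → (h u v ≢ c) × (h v u ≢ c)

GoodHalfEdgeColoring : ∀ {n} → Graph n → HalfEdgeAssignment n → Set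
GoodHalfEdgeColoring G h =
  ProperHalfEdgeColoring G h × (∀ (C : Cycle G) → ¬ BadCycle h C)

module Submission where

-- At a vertex x of a bad cycle with cycle neighbours u ≠ w, properness and
-- the missing colour force a swap: h u x = h x w and h w x = h x u
-- (badCycle⇒swap).  We therefore colour the graph one vertex at a time: when
-- v is added, the colours σ on its half-edges are chosen by a local rule that
-- forbids a swap at v, and then no bad cycle can appear (module Extension).
-- A local rule exists whenever a neighbour of v is still uncoloured
-- (oneColouredSlot, twoColouredSlots); a vertex whose three neighbours are
-- already coloured needs three distinct incoming colours (shiftRule).  To
-- secure these, the induction over vertex sets S (colour) maintains up to
-- three targets: vertices of S with a neighbour outside S, each keeping its
-- own free colour, the three colours being distinct (GoodOn).

open import Defs
open import Data.Nat using (ℕ; zero; suc; _+_; _≤_)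
import Data.Nat.Properties as ℕₚ
open import Data.Bool using (T)
open import Data.Fin using (Fin; zero; suc; _≟_; toℕ; inject₁; fromℕ)
open import Data.Fin.Properties using (any?; toℕ-inject₁; toℕ-fromℕ)
open import Data.Fin.Subset using (Subset; _-_; _─_; ∣_∣; ⊤; ⁅_⁆; outside; inside)
  renaming (_∈_ to _∈S_; _∉_ to _∉S_)
open import Data.Fin.Subset.Properties
  using (_∈?_; x∈p∧x≢y⇒x∈p-y; p─q⊆p; x∈⁅x⁆; x∈p⇒∣p-x∣<∣p∣; ∈⊤)
open import Data.List using (List; []; _∷_; length; filter)
open import Data.List using () renaming (allFin to allFinL)
open import Data.List.Membership.Propositional using (_∈_)
open import Data.List.Membership.Propositional.Properties using (∈-filter⁺; ∈-filter⁻; ∈-allFin)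
open import Data.List.Relation.Unary.Any using (here; there)
open import Data.List.Relation.Unary.Unique.Propositional using (Unique)
open import Data.List.Relation.Unary.Unique.Propositional.Properties using (filter⁺; allFin⁺)
open import Data.List.Relation.Unary.AllPairs using ([]; _∷_)
open import Data.List.Relation.Unary.All using ([]; _∷_)
open import Data.Maybe using (Maybe; just; nothing)
open import Data.Maybe.Properties using (just-injective) renaming (≡-dec to ≡-decMaybe)
open import Data.Product using (Σ; ∃; _×_; _,_; proj₁; proj₂)
open import Data.Sum using (_⊎_; inj₁; inj₂)
open import Data.Empty using (⊥; ⊥-elim)
open import Data.Unit using (tt) renaming (⊤ to Unit)
open import Data.Vec using (_∷_; here; there)
open import Function.Definitions using (Injective)
open import Relation.Binary.PropositionalEquality
  using (_≡_; _≢_; refl; sym; trans; cong; subst; module ≡-Reasoning)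
open import Relation.Nullary using (¬_; Dec; yes; no)
open import Relation.Nullary.Decidable using (T?; _×-dec_; ¬?)

Col : Set
Col = Fin 3

third : Col → Col → Col
third zero             zero             = suc zero
third zero             (suc zero)       = suc (suc zero)
third zero             (suc (suc zero)) = suc zero
third (suc zero)       zero             = suc (suc zero)
third (suc zero)       (suc zero)       = zero
third (suc zero)       (suc (suc zero)) = zero
third (suc (suc zero)) zero             = suc zero
third (suc (suc zero)) (suc zero)       = zero
third (suc (suc zero)) (suc (suc zero)) = zero

third-≢₁ : ∀ a b → third a b ≢ a
third-≢₁ zero             zero             ()
third-≢₁ zero             (suc zero)       ()
third-≢₁ zero             (suc (suc zero)) ()
third-≢₁ (suc zero)       zero             ()
third-≢₁ (suc zero)       (suc zero)       ()
third-≢₁ (suc zero)       (suc (suc zero)) ()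
third-≢₁ (suc (suc zero)) zero             ()
third-≢₁ (suc (suc zero)) (suc zero)       ()
third-≢₁ (suc (suc zero)) (suc (suc zero)) ()

third-≢₂ : ∀ a b → third a b ≢ b
third-≢₂ zero             zero             ()
third-≢₂ zero             (suc zero)       ()
third-≢₂ zero             (suc (suc zero)) ()
third-≢₂ (suc zero)       zero             ()
third-≢₂ (suc zero)       (suc zero)       ()
third-≢₂ (suc zero)       (suc (suc zero)) ()
third-≢₂ (suc (suc zero)) zero             ()
third-≢₂ (suc (suc zero)) (suc zero)       ()
third-≢₂ (suc (suc zero)) (suc (suc zero)) ()

third-unique : ∀ {a b x : Fin 3} → a ≢ b → x ≢ a → x ≢ b → x ≡ third a b
third-unique {zero}           {zero}           {_}              a≢b _   _   = ⊥-elim (a≢b refl)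
third-unique {zero}           {suc zero}       {zero}           _   x≢a _   = ⊥-elim (x≢a refl)
third-unique {zero}           {suc zero}       {suc zero}       _   _   x≢b = ⊥-elim (x≢b refl)
third-unique {zero}           {suc zero}       {suc (suc zero)} _   _   _   = refl
third-unique {zero}           {suc (suc zero)} {zero}           _   x≢a _   = ⊥-elim (x≢a refl)
third-unique {zero}           {suc (suc zero)} {suc zero}       _   _   _   = refl
third-unique {zero}           {suc (suc zero)} {suc (suc zero)} _   _   x≢b = ⊥-elim (x≢b refl)
third-unique {suc zero}       {zero}           {zero}           _   _   x≢b = ⊥-elim (x≢b refl)
third-unique {suc zero}       {zero}           {suc zero}       _   x≢a _   = ⊥-elim (x≢a refl)
third-unique {suc zero}       {zero}           {suc (suc zero)} _   _   _   = refl
third-unique {suc zero}       {suc zero}       {_}              a≢b _   _   = ⊥-elim (a≢b refl)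
third-unique {suc zero}       {suc (suc zero)} {zero}           _   _   _   = refl
third-unique {suc zero}       {suc (suc zero)} {suc zero}       _   x≢a _   = ⊥-elim (x≢a refl)
third-unique {suc zero}       {suc (suc zero)} {suc (suc zero)} _   _   x≢b = ⊥-elim (x≢b refl)
third-unique {suc (suc zero)} {zero}           {zero}           _   _   x≢b = ⊥-elim (x≢b refl)
third-unique {suc (suc zero)} {zero}           {suc zero}       _   _   _   = refl
third-unique {suc (suc zero)} {zero}           {suc (suc zero)} _   x≢a _   = ⊥-elim (x≢a refl)
third-unique {suc (suc zero)} {suc zero}       {zero}           _   _   _   = refl
third-unique {suc (suc zero)} {suc zero}       {suc zero}       _   _   x≢b = ⊥-elim (x≢b refl)
third-unique {suc (suc zero)} {suc zero}       {suc (suc zero)} _   x≢a _   = ⊥-elim (x≢a refl)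
third-unique {suc (suc zero)} {suc (suc zero)} {_}              a≢b _   _   = ⊥-elim (a≢b refl)

sameThird : ∀ {a b x y : Col} → a ≢ b → x ≢ a → x ≢ b → y ≢ a → y ≢ b → x ≡ y
sameThird a≢b x≢a x≢b y≢a y≢b = trans (third-unique a≢b x≢a x≢b) (sym (third-unique a≢b y≢a y≢b))

next : Fin 3 → Fin 3
next zero             = suc zero
next (suc zero)       = suc (suc zero)
next (suc (suc zero)) = zero

next-≢ : ∀ x → next x ≢ x
next-≢ zero             ()
next-≢ (suc zero)       ()
next-≢ (suc (suc zero)) ()

next²-≢ : ∀ x → x ≢ next (next x)
next²-≢ zero             ()
next²-≢ (suc zero)       ()
next²-≢ (suc (suc zero)) ()

next-injective : ∀ {x y} → next x ≡ next y → x ≡ y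
next-injective {zero}           {zero}           _  = refl
next-injective {suc zero}       {suc zero}       _  = refl
next-injective {suc (suc zero)} {suc (suc zero)} _  = refl
next-injective {zero}           {suc zero}       ()
next-injective {zero}           {suc (suc zero)} ()
next-injective {suc zero}       {zero}           ()
next-injective {suc zero}       {suc (suc zero)} ()
next-injective {suc (suc zero)} {zero}           ()
next-injective {suc (suc zero)} {suc zero}       ()

-- When a vertex v is added to an already coloured part of the graph, its
-- three neighbour slots i split into the coloured ones (A i) and the rest.
-- For a coloured slot, q i is the colour of the half-edge pointing from the
-- neighbour to v, and σ i is the colour we choose for the half-edge from v
-- to that neighbour.  A local rule asks for distinct colours at v, distinct
-- colours on each edge, and no "swap" between two edges at v: the pattern
-- q i = σ j, q j = σ i is exactly what a bad cycle through v would exhibit.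

record LocalRule (A : Fin 3 → Set) (q σ : Fin 3 → Col) : Set where
  field
    σ-injective : ∀ {i j} → A i → A j → σ i ≡ σ j → i ≡ j
    σ≢q         : ∀ {i} → A i → σ i ≢ q i
    noSwap      : ∀ {i j} → A i → A j → i ≢ j → q i ≡ σ j → q j ≢ σ i

shiftRule : ∀ {A : Fin 3 → Set} {q : Fin 3 → Col} → Injective _≡_ _≡_ q →
  LocalRule A q (λ i → next (q i))
shiftRule {q = q} q-injective = record
  { σ-injective = λ _ _ e → q-injective (next-injective e)
  ; σ≢q         = λ {i} _ → next-≢ (q i)
  ; noSwap      = λ {i} _ _ _ qi≡σj qj≡σi → next²-≢ (q i) (trans qi≡σj (cong next qj≡σi))
  }

oneColouredSlot : ∀ {A : Fin 3 → Set} {j j'} → ¬ A j → ¬ A j' → j ≢ j' →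
  ∀ (q : Fin 3 → Col) (g : Col) →
  Σ (Fin 3 → Col) λ σ → LocalRule A q σ × (∀ {i} → A i → σ i ≢ g)
oneColouredSlot {A} {j} {j'} ¬Aj ¬Aj' j≢j' q g = σ , rule , λ {i} _ → third-≢₂ (q i) g
  where
  σ : Fin 3 → Col
  σ i = third (q i) g

  theSlot : ∀ {i} → A i → i ≡ third j j'
  theSlot Ai = third-unique j≢j' (λ { refl → ¬Aj Ai }) (λ { refl → ¬Aj' Ai })

  sameSlot : ∀ {i i'} → A i → A i' → i ≡ i'
  sameSlot Ai Ai' = trans (theSlot Ai) (sym (theSlot Ai'))

  rule : LocalRule A q σ
  rule = record
    { σ-injective = λ Ai Ai' _ → sameSlot Ai Ai'
    ; σ≢q         = λ {i} _ → third-≢₁ (q i) g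
    ; noSwap      = λ Ai Aj i≢j _ _ → i≢j (sameSlot Ai Aj)
    }

twoColouredSlots : ∀ {A : Fin 3 → Set} {j0 j1} → ¬ A j0 → j1 ≢ j0 →
  ∀ (q : Fin 3 → Col) →
  Σ (Fin 3 → Col) λ σ → LocalRule A q σ × (∀ {i} → A i → σ i ≢ q j1)
twoColouredSlots {A} {j0} {j1} ¬Aj0 j1≢j0 q = σ , rule , avoid
  where
  j2 : Fin 3
  j2 = third j1 j0

  c d : Col
  c = third (q j1) (q j2)
  d = third (q j1) c

  choose : ∀ {i} → Dec (i ≡ j1) → Col
  choose (yes _) = d
  choose (no  _) = c

  σ : Fin 3 → Col
  σ i = choose (i ≟ j1)

  data ColouredSlot (i : Fin 3) (x : Col) : Set where
    at-j1 : i ≡ j1 → x ≡ d → ColouredSlot i x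
    at-j2 : i ≡ j2 → x ≡ c → ColouredSlot i x

  classify : ∀ {i} → A i → (p : Dec (i ≡ j1)) → ColouredSlot i (choose p)
  classify Ai (yes i≡j1) = at-j1 i≡j1 refl
  classify Ai (no  i≢j1) = at-j2 (third-unique j1≢j0 i≢j1 (λ { refl → ¬Aj0 Ai })) refl

  view : ∀ {i} → A i → ColouredSlot i (σ i)
  view {i} Ai = classify Ai (i ≟ j1)

  d≢c : d ≢ c
  d≢c = third-≢₂ (q j1) c

  c≢qj1 : c ≢ q j1
  c≢qj1 = third-≢₁ (q j1) (q j2)

  σ-injective : ∀ {i i'} → A i → A i' → σ i ≡ σ i' → i ≡ i'
  σ-injective Ai Ai' e with view Ai | view Ai'
  ... | at-j1 refl _  | at-j1 refl _  = refl
  ... | at-j2 refl _  | at-j2 refl _  = refl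
  ... | at-j1 _    s₁ | at-j2 _    s₂ = ⊥-elim (d≢c (trans (sym s₁) (trans e s₂)))
  ... | at-j2 _    s₁ | at-j1 _    s₂ = ⊥-elim (d≢c (trans (sym s₂) (trans (sym e) s₁)))

  σ≢q : ∀ {i} → A i → σ i ≢ q i
  σ≢q Ai with view Ai
  ... | at-j1 refl s = λ e → third-≢₁ (q j1) c (trans (sym s) e)
  ... | at-j2 refl s = λ e → third-≢₂ (q j1) (q j2) (trans (sym s) e)

  avoid : ∀ {i} → A i → σ i ≢ q j1
  avoid Ai with view Ai
  ... | at-j1 refl s = λ e → third-≢₁ (q j1) c (trans (sym s) e)
  ... | at-j2 refl s = λ e → c≢qj1 (trans (sym s) e)

  noSwap : ∀ {i i'} → A i → A i' → i ≢ i' → q i ≡ σ i' → q i' ≢ σ i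
  noSwap Ai Ai' i≢i' qi≡σi' qi'≡σi with view Ai | view Ai'
  ... | at-j1 refl _ | at-j1 refl _ = i≢i' refl
  ... | at-j2 refl _ | at-j2 refl _ = i≢i' refl
  ... | at-j1 refl _ | at-j2 _    s = c≢qj1 (sym (trans qi≡σi' s))
  ... | at-j2 _    s | at-j1 refl _ = c≢qj1 (sym (trans qi'≡σi s))

  rule : LocalRule A q σ
  rule = record { σ-injective = σ-injective ; σ≢q = σ≢q ; noSwap = noSwap }

enumerateThree : ∀ {n} (L : List (Fin n)) → length L ≡ 3 → Unique L →
  Σ (Fin 3 → Fin n) λ g →
    Injective _≡_ _≡_ g × (∀ i → g i ∈ L) × (∀ y → y ∈ L → ∃ λ i → g i ≡ y)
enumerateThree (a ∷ b ∷ c ∷ []) refl ((a≢b ∷ a≢c ∷ []) ∷ (b≢c ∷ []) ∷ [] ∷ []) =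
  g , g-injective , g-∈ , g-onto
  where
  g : Fin 3 → _
  g zero             = a
  g (suc zero)       = b
  g (suc (suc zero)) = c

  g-injective : Injective _≡_ _≡_ g
  g-injective {zero}           {zero}           _ = refl
  g-injective {suc zero}       {suc zero}       _ = refl
  g-injective {suc (suc zero)} {suc (suc zero)} _ = refl
  g-injective {zero}           {suc zero}       e = ⊥-elim (a≢b e)
  g-injective {zero}           {suc (suc zero)} e = ⊥-elim (a≢c e)
  g-injective {suc zero}       {zero}           e = ⊥-elim (a≢b (sym e))
  g-injective {suc zero}       {suc (suc zero)} e = ⊥-elim (b≢c e)
  g-injective {suc (suc zero)} {zero}           e = ⊥-elim (a≢c (sym e))
  g-injective {suc (suc zero)} {suc zero}       e = ⊥-elim (b≢c (sym e))

  g-∈ : ∀ i → g i ∈ _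
  g-∈ zero             = here refl
  g-∈ (suc zero)       = there (here refl)
  g-∈ (suc (suc zero)) = there (there (here refl))

  g-onto : ∀ y → y ∈ _ → ∃ λ i → g i ≡ y
  g-onto y (here e)                 = zero , sym e
  g-onto y (there (here e))         = suc zero , sym e
  g-onto y (there (there (here e))) = suc (suc zero) , sym e

record NeighbourSlots {n : ℕ} (G : Graph n) : Set where
  field
    N          : Fin n → Fin 3 → Fin n
    N-adj      : ∀ x i → Adj G x (N x i)
    N-injective : ∀ x {i j} → N x i ≡ N x j → i ≡ j
    N-onto     : ∀ x y → Adj G x y → ∃ λ i → N x i ≡ y

neighbourSlots : ∀ {n} (G : Graph n) → Cubic G → NeighbourSlots G
neighbourSlots {n} G cubic = record
  { N           = λ x → proj₁ (slots x)
  ; N-adj       = λ x i → proj₂ (∈-filter⁻ (isNbr x) {xs = allFinL n} (proj₁ (proj₂ (proj₂ (slots x))) i))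
  ; N-injective = λ x → proj₁ (proj₂ (slots x))
  ; N-onto      = λ x y x~y → proj₂ (proj₂ (proj₂ (slots x))) y (∈-filter⁺ (isNbr x) (∈-allFin y) x~y)
  }
  where
  isNbr : ∀ x y → Dec (Adj G x y)
  isNbr x y = T? (adj G x y)

  neighbours : Fin n → List (Fin n)
  neighbours x = filter (isNbr x) (allFinL n)

  slots : ∀ x → Σ (Fin 3 → Fin n) λ g → Injective _≡_ _≡_ g × (∀ i → g i ∈ neighbours x) ×
                                          (∀ y → y ∈ neighbours x → ∃ λ i → g i ≡ y)
  slots x = enumerateThree (neighbours x) (cubic x) (filter⁺ (isNbr x) (allFin⁺ n))

∈─⇒∉ : ∀ {m} {x : Fin m} (p q : Subset m) → x ∈S (p ─ q) → x ∉S q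
∈─⇒∉ (_ ∷ p) (outside ∷ q) here      ()
∈─⇒∉ (_ ∷ p) (outside ∷ q) (there a) (there b) = ∈─⇒∉ p q a b
∈─⇒∉ (_ ∷ p) (inside  ∷ q) (there a) (there b) = ∈─⇒∉ p q a b

module _ {m : ℕ} {S : Subset m} {y v : Fin m} where

  ∈-remove : y ∈S S → y ≢ v → y ∈S (S - v)
  ∈-remove = x∈p∧x≢y⇒x∈p-y

  remove-⊆ : y ∈S (S - v) → y ∈S S
  remove-⊆ = p─q⊆p S ⁅ v ⁆

  remove-≢ : y ∈S (S - v) → y ≢ v
  remove-≢ y∈ refl = ∈─⇒∉ S ⁅ v ⁆ y∈ (x∈⁅x⁆ v)

injectOrLast : ∀ {m} (i : Fin (suc m)) → (∃ λ j → i ≡ inject₁ j) ⊎ i ≡ fromℕ m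
injectOrLast {zero}  zero    = inj₂ refl
injectOrLast {suc m} zero    = inj₁ (zero , refl)
injectOrLast {suc m} (suc i) with injectOrLast i
... | inj₁ (j , e) = inj₁ (suc j , cong suc e)
... | inj₂ e       = inj₂ (cong suc e)

module _ {n : ℕ} {G : Graph n} (C : Cycle G) where

  cycleEdge-adj : ∀ {u w} → CycleEdge C u w → Adj G u w
  cycleEdge-adj (inj₁ (i , refl , refl)) = step C i
  cycleEdge-adj (inj₂ (refl , refl))     = close C

  OnCycle : Fin n → Set
  OnCycle u = ∃ λ i → u ≡ vs C i

  cycleEdge-ends : ∀ {u w} → CycleEdge C u w → OnCycle u × OnCycle w
  cycleEdge-ends (inj₁ (i , u≡ , w≡)) = (inject₁ i , u≡) , (suc i , w≡)
  cycleEdge-ends (inj₂ (u≡ , w≡))     = (fromℕ (2 + k C) , u≡) , (zero , w≡)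

  -- Each vertex of a cycle is entered from one cycle neighbour and left
  -- towards another; since a cycle has at least three vertices, these two
  -- neighbours are different.
  record Passage (x : Fin n) : Set where
    field
      pred succ  : Fin n
      enter      : CycleEdge C pred x
      leave      : CycleEdge C x succ
      pred≢succ  : pred ≢ succ

  passage : ∀ i → Passage (vs C i)
  passage zero = record
    { pred = vs C (fromℕ (2 + k C)) ; succ = vs C (suc zero)
    ; enter = inj₂ (refl , refl) ; leave = inj₁ (zero , refl , refl)
    ; pred≢succ = λ e → last≢one (distinct C e) }
    where
    last≢one : fromℕ (2 + k C) ≢ suc zero
    last≢one ()
  passage (suc j) with injectOrLast (suc j)
  ... | inj₁ (j' , sj≡j') = record
    { pred = vs C (inject₁ j) ; succ = vs C (suc j')
    ; enter = inj₁ (j , refl , refl) ; leave = inj₁ (j' , cong (vs C) sj≡j' , refl)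
    ; pred≢succ = λ e → indices≢ (distinct C e) }
    where
    -- j' = j + 1, so j = j' + 1 would give j' = j' + 2
    indices≢ : inject₁ j ≢ suc j'
    indices≢ e = ℕₚ.m≢1+n+m (toℕ j') {1} j'≡j'+2
      where
      open ≡-Reasoning
      j'≡j'+2 : toℕ j' ≡ suc (suc (toℕ j'))
      j'≡j'+2 = begin
        toℕ j'                 ≡⟨ toℕ-inject₁ j' ⟨
        toℕ (inject₁ j')       ≡⟨ cong toℕ sj≡j' ⟨
        suc (toℕ j)            ≡⟨ cong suc (toℕ-inject₁ j) ⟨
        suc (toℕ (inject₁ j))  ≡⟨ cong (λ i → suc (toℕ i)) e ⟩
        suc (suc (toℕ j'))     ∎
  ... | inj₂ sj≡last = record
    { pred = vs C (inject₁ j) ; succ = vs C zero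
    ; enter = inj₁ (j , refl , refl) ; leave = inj₂ (cong (vs C) sj≡last , refl)
    ; pred≢succ = λ e → indices≢ (distinct C e) }
    where
    -- j + 1 is the last index 2 + k, so j ≠ 0
    indices≢ : inject₁ j ≢ zero
    indices≢ e = one≢last 1≡2+k
      where
      open ≡-Reasoning
      one≢last : 1 ≢ 2 + k C
      one≢last ()
      1≡2+k : 1 ≡ 2 + k C
      1≡2+k = begin
        1                          ≡⟨ cong (λ i → suc (toℕ i)) e ⟨
        suc (toℕ (inject₁ j))      ≡⟨ cong suc (toℕ-inject₁ j) ⟩
        toℕ (suc j)                ≡⟨ cong toℕ sj≡last ⟩
        toℕ (fromℕ (2 + k C))      ≡⟨ toℕ-fromℕ (2 + k C) ⟩
        2 + k C                    ∎

module Construction {n : ℕ} (G : Graph n) (slots : NeighbourSlots G) where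
  open NeighbourSlots slots

  HalfEdges : Set
  HalfEdges = HalfEdgeAssignment n

  Vertices : Set
  Vertices = Subset n

  adj-sym : ∀ {x y} → Adj G x y → Adj G y x
  adj-sym {x} {y} = subst T (symm G x y)

  adj-≢ : ∀ {x y} → Adj G x y → x ≢ y
  adj-≢ {x} x~x refl = subst T (irrefl G x) x~x

  N-≢ : ∀ x i → N x i ≢ x
  N-≢ x i e = adj-≢ (N-adj x i) (sym e)

  slotOf : ∀ {x y} → Adj G x y → Fin 3
  slotOf {x} {y} x~y = proj₁ (N-onto x y x~y)

  N-slotOf : ∀ {x y} (x~y : Adj G x y) → N x (slotOf x~y) ≡ y
  N-slotOf {x} {y} x~y = proj₂ (N-onto x y x~y)

  record ProperOn (S : Vertices) (h : HalfEdges) : Set where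
    field
      atVertex : ∀ {x y z} → x ∈S S → y ∈S S → z ∈S S → Adj G x y → Adj G x z →
                 y ≢ z → h x y ≢ h x z
      atEdge   : ∀ {x y} → x ∈S S → y ∈S S → Adj G x y → h x y ≢ h y x

  NoBadCycleIn : Vertices → HalfEdges → Set
  NoBadCycleIn S h = ∀ (C : Cycle G) → (∀ i → vs C i ∈S S) → ¬ BadCycle h C

  FreeAt : Vertices → HalfEdges → Fin n → Col → Set
  FreeAt S h y c = ∀ {z} → z ∈S S → Adj G y z → h y z ≢ c

  Into : Vertices → Fin n → Fin 3 → Set
  Into S y i = N y i ∈S S

  Deficient : Vertices → Fin n → Set
  Deficient S y = ∃ λ j → N y j ∉S S

  record SwapAt (S : Vertices) (h : HalfEdges) (x : Fin n) : Set where
    field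
      u w   : Fin n
      u≢w   : u ≢ w
      u∈S   : u ∈S S
      w∈S   : w ∈S S
      x~u   : Adj G x u
      x~w   : Adj G x w
      swap₁ : h u x ≡ h x w
      swap₂ : h w x ≡ h x u

  -- Let c be the colour missing from the bad cycle.  At x the colours of
  -- x→u and x→w differ and avoid c, so u→x, avoiding both c and the colour of
  -- x→u, must carry the colour of x→w; symmetrically for w→x.
  badCycle⇒swap : ∀ {S h} → ProperOn S h → (C : Cycle G) → (∀ i → vs C i ∈S S) →
                  BadCycle h C → ∀ i → SwapAt S h (vs C i)
  badCycle⇒swap {S} {h} proper C inS (c , avoids) i = record
    { u = u ; w = w ; u≢w = u≢w ; u∈S = u∈S ; w∈S = w∈S ; x~u = x~u ; x~w = x~w
    ; swap₁ = sameThird c≢hxu (proj₁ avoid-ux) (atEdge u∈S x∈S u~x) (proj₁ avoid-xw) hxw≢hxu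
    ; swap₂ = sameThird c≢hxw (proj₂ avoid-xw) (λ e → atEdge x∈S w∈S x~w (sym e))
                        (proj₂ avoid-ux) (λ e → hxw≢hxu (sym e)) }
    where
    open ProperOn proper
    open Passage (passage C i) renaming (pred to u; succ to w; pred≢succ to u≢w)
    x : Fin n
    x = vs C i
    x∈S : x ∈S S
    x∈S = inS i
    onCycle⇒∈S : ∀ {y} → OnCycle C y → y ∈S S
    onCycle⇒∈S (j , refl) = inS j
    u∈S : u ∈S S
    u∈S = onCycle⇒∈S (proj₁ (cycleEdge-ends C enter))
    w∈S : w ∈S S
    w∈S = onCycle⇒∈S (proj₂ (cycleEdge-ends C leave))
    u~x : Adj G u x
    u~x = cycleEdge-adj C enter
    x~u : Adj G x u
    x~u = adj-sym u~x
    x~w : Adj G x w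
    x~w = cycleEdge-adj C leave
    avoid-ux : (h u x ≢ c) × (h x u ≢ c)
    avoid-ux = avoids u x enter
    avoid-xw : (h x w ≢ c) × (h w x ≢ c)
    avoid-xw = avoids x w leave
    hxw≢hxu : h x w ≢ h x u
    hxw≢hxu = atVertex x∈S w∈S u∈S x~w x~u (λ e → u≢w (sym e))
    c≢hxu : c ≢ h x u
    c≢hxu e = proj₂ avoid-ux (sym e)
    c≢hxw : c ≢ h x w
    c≢hxw e = proj₁ avoid-xw (sym e)

  bySlot : Fin n → (Fin 3 → Col) → Fin n → Col
  bySlot v g y with y ≟ N v zero
  ... | yes _ = g zero
  ... | no  _ with y ≟ N v (suc zero)
  ...   | yes _ = g (suc zero)
  ...   | no  _ = g (suc (suc zero))

  bySlot-N : ∀ v g i → bySlot v g (N v i) ≡ g i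
  bySlot-N v g i with N v i ≟ N v zero
  ... | yes e = cong g (sym (N-injective v e))
  ... | no ne with N v i ≟ N v (suc zero)
  ...   | yes e = cong g (sym (N-injective v e))
  bySlot-N v g zero             | no ne | no _   = ⊥-elim (ne refl)
  bySlot-N v g (suc zero)       | no _  | no ne′ = ⊥-elim (ne′ refl)
  bySlot-N v g (suc (suc zero)) | no _  | no _   = refl

  extend : HalfEdges → Fin n → (Fin 3 → Col) → (Fin 3 → Col) → HalfEdges
  extend h v σ q x y with x ≟ v
  ... | yes _ = bySlot v σ y
  ... | no  _ with y ≟ v
  ...   | yes _ = bySlot v q x
  ...   | no  _ = h x y

  extend-out : ∀ h v σ q i → extend h v σ q v (N v i) ≡ σ i
  extend-out h v σ q i with v ≟ v
  ... | yes _ = bySlot-N v σ i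
  ... | no ne = ⊥-elim (ne refl)

  extend-in : ∀ h v σ q i → extend h v σ q (N v i) v ≡ q i
  extend-in h v σ q i with N v i ≟ v
  ... | yes e = ⊥-elim (N-≢ v i e)
  ... | no _ with v ≟ v
  ...   | yes _ = bySlot-N v q i
  ...   | no ne = ⊥-elim (ne refl)

  extend-old : ∀ h v σ q {x y} → x ≢ v → y ≢ v → extend h v σ q x y ≡ h x y
  extend-old h v σ q {x} {y} x≢v y≢v with x ≟ v
  ... | yes e = ⊥-elim (x≢v e)
  ... | no _ with y ≟ v
  ...   | yes e = ⊥-elim (y≢v e)
  ...   | no _ = refl

  record Extendable (S : Vertices) (v : Fin n) (h : HalfEdges) (q σ : Fin 3 → Col) : Set where
    field
      q-free : ∀ i → N v i ∈S S → FreeAt (S - v) h (N v i) (q i)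
      rule   : LocalRule (Into S v) q σ
    open LocalRule rule public

  module Extension {S : Vertices} {v : Fin n} {h : HalfEdges} {q σ : Fin 3 → Col}
                   (v∈S : v ∈S S) (ok : Extendable S v h q σ) where
    open Extendable ok

    h′ : HalfEdges
    h′ = extend h v σ q

    out : ∀ {y} (v~y : Adj G v y) → h′ v y ≡ σ (slotOf v~y)
    out v~y = subst (λ z → h′ v z ≡ σ (slotOf v~y)) (N-slotOf v~y) (extend-out h v σ q (slotOf v~y))

    into : ∀ {y} (v~y : Adj G v y) → h′ y v ≡ q (slotOf v~y)
    into v~y = subst (λ z → h′ z v ≡ q (slotOf v~y)) (N-slotOf v~y) (extend-in h v σ q (slotOf v~y))

    old : ∀ {x y} → x ≢ v → y ≢ v → h′ x y ≡ h x y
    old = extend-old h v σ q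

    slot∈S : ∀ {y} (v~y : Adj G v y) → y ∈S S → N v (slotOf v~y) ∈S S
    slot∈S v~y y∈S = subst (_∈S S) (sym (N-slotOf v~y)) y∈S

    intoV≢old : ∀ {x z} → x ∈S S → x ≢ v → z ∈S S → z ≢ v → Adj G x v → Adj G x z →
                h′ x v ≢ h′ x z
    intoV≢old {x} {z} x∈S x≢v z∈S z≢v x~v x~z e =
      q-free i (slot∈S v~x x∈S) z∈S-v (subst (λ y → Adj G y z) (sym (N-slotOf v~x)) x~z) (sym qi≡hxz)
      where
      v~x : Adj G v x
      v~x = adj-sym x~v
      i : Fin 3
      i = slotOf v~x
      z∈S-v : z ∈S (S - v)
      z∈S-v = ∈-remove z∈S z≢v
      qi≡hxz : q i ≡ h (N v i) z
      qi≡hxz = begin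
        q i        ≡⟨ into v~x ⟨
        h′ x v     ≡⟨ e ⟩
        h′ x z     ≡⟨ old x≢v z≢v ⟩
        h x z      ≡⟨ cong (λ y → h y z) (N-slotOf v~x) ⟨
        h (N v i) z ∎
        where open ≡-Reasoning

    -- Properness at v comes from the local rule, at the neighbours of v from
    -- the incoming colours being free, and elsewhere from h.
    extend-proper : ProperOn (S - v) h → ProperOn S h′
    extend-proper proper = record { atVertex = atVertex′ ; atEdge = atEdge′ }
      where
      open ProperOn proper

      atVertex′ : ∀ {x y z} → x ∈S S → y ∈S S → z ∈S S → Adj G x y → Adj G x z →
                  y ≢ z → h′ x y ≢ h′ x z
      atVertex′ {x} {y} {z} x∈S y∈S z∈S x~y x~z y≢z = byCases (x ≟ v)
        where
        byCases : Dec (x ≡ v) → h′ x y ≢ h′ x z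
        byCases (yes refl) e = y≢z (trans (sym (N-slotOf x~y)) (trans (cong (N v) sameSlot) (N-slotOf x~z)))
          where
          sameSlot : slotOf x~y ≡ slotOf x~z
          sameSlot = σ-injective (slot∈S x~y y∈S) (slot∈S x~z z∈S) (trans (sym (out x~y)) (trans e (out x~z)))
        byCases (no x≢v) with y ≟ v | z ≟ v
        ... | yes refl | yes refl = ⊥-elim (y≢z refl)
        ... | yes refl | no z≢v   = intoV≢old x∈S x≢v z∈S z≢v x~y x~z
        ... | no y≢v   | yes refl = λ e → intoV≢old x∈S x≢v y∈S y≢v x~z x~y (sym e)
        ... | no y≢v   | no z≢v   = λ e → atVertex (∈-remove x∈S x≢v) (∈-remove y∈S y≢v) (∈-remove z∈S z≢v)
                                            x~y x~z y≢z (trans (sym (old x≢v y≢v)) (trans e (old x≢v z≢v)))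

      atEdge′ : ∀ {x y} → x ∈S S → y ∈S S → Adj G x y → h′ x y ≢ h′ y x
      atEdge′ {x} {y} x∈S y∈S x~y = byCases (x ≟ v) (y ≟ v)
        where
        y~x : Adj G y x
        y~x = adj-sym x~y
        byCases : Dec (x ≡ v) → Dec (y ≡ v) → h′ x y ≢ h′ y x
        byCases (yes refl) _          e = σ≢q (slot∈S x~y y∈S) (trans (sym (out x~y)) (trans e (into x~y)))
        byCases (no x≢v)   (yes refl) e = σ≢q (slot∈S y~x x∈S) (trans (sym (out y~x)) (trans (sym e) (into y~x)))
        byCases (no x≢v)   (no y≢v)   e = atEdge (∈-remove x∈S x≢v) (∈-remove y∈S y≢v) x~y
                                          (trans (sym (old x≢v y≢v)) (trans e (old y≢v x≢v)))

    -- The local rule forbids exactly the swap a bad cycle through v needs.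
    noSwapAtV : ¬ SwapAt S h′ v
    noSwapAtV swap = noSwap (slot∈S x~u u∈S) (slot∈S x~w w∈S) a≢b qa≡σb qb≡σa
      where
      open SwapAt swap
      a≢b : slotOf x~u ≢ slotOf x~w
      a≢b e = u≢w (trans (sym (N-slotOf x~u)) (trans (cong (N v) e) (N-slotOf x~w)))
      qa≡σb : q (slotOf x~u) ≡ σ (slotOf x~w)
      qa≡σb = trans (sym (into x~u)) (trans swap₁ (out x~w))
      qb≡σa : q (slotOf x~w) ≡ σ (slotOf x~u)
      qb≡σa = trans (sym (into x~w)) (trans swap₂ (out x~u))

    -- A bad cycle through v is excluded by the local rule; one avoiding v was
    -- already bad for h, which agrees with h′ away from v.
    extend-noBadCycle : ProperOn (S - v) h → NoBadCycleIn (S - v) h → NoBadCycleIn S h′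
    extend-noBadCycle proper noBad C inS bad@(c , avoids) with any? (λ i → vs C i ≟ v)
    ... | yes (i , vi≡v) = noSwapAtV (subst (SwapAt S h′) vi≡v (badCycle⇒swap (extend-proper proper) C inS bad i))
    ... | no  avoidsV    = noBad C (λ i → ∈-remove (inS i) (λ e → avoidsV (i , e))) (c , avoids′)
      where
      offV : ∀ {y} → OnCycle C y → y ≢ v
      offV (i , refl) e = avoidsV (i , e)
      avoids′ : ∀ u w → CycleEdge C u w → (h u w ≢ c) × (h w u ≢ c)
      avoids′ u w uw = (λ e → proj₁ (avoids u w uw) (trans (old u≢v w≢v) e))
                     , (λ e → proj₂ (avoids u w uw) (trans (old w≢v u≢v) e))
        where
        u≢v : u ≢ v
        u≢v = offV (proj₁ (cycleEdge-ends C uw))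
        w≢v : w ≢ v
        w≢v = offV (proj₂ (cycleEdge-ends C uw))

    extend-freeOld : ∀ {t c} → t ≢ v → FreeAt (S - v) h t c → (∀ i → N v i ≡ t → q i ≢ c) →
                     FreeAt S h′ t c
    extend-freeOld {t} t≢v free qAvoids {z} z∈S t~z with z ≟ v
    ... | yes refl = λ e → qAvoids (slotOf v~t) (N-slotOf v~t) (trans (sym (into v~t)) e)
      where
      v~t : Adj G v t
      v~t = adj-sym t~z
    ... | no  z≢v  = λ e → free (∈-remove z∈S z≢v) t~z (trans (sym (old t≢v z≢v)) e)

    extend-freeNew : ∀ {c} → (∀ i → N v i ∈S S → σ i ≢ c) → FreeAt S h′ v c
    extend-freeNew σAvoids z∈S v~z e = σAvoids (slotOf v~z) (slot∈S v~z z∈S) (trans (sym (out v~z)) e)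

  atSlot : ∀ (h : HalfEdges) {y z} (y~z : Adj G y z) → h y z ≡ h y (N y (slotOf y~z))
  atSlot h {y} y~z = cong (h y) (sym (N-slotOf y~z))

  slot≢outside : ∀ {S : Vertices} {y z j} → N y j ∉S S → z ∈S S → (y~z : Adj G y z) → slotOf y~z ≢ j
  slot≢outside {S} out z∈S y~z refl = out (subst (_∈S S) (sym (N-slotOf y~z)) z∈S)

  -- One slot of y leads outside S: the two other half-edges at y leave a
  -- colour free.
  freeColour : ∀ {S : Vertices} (h : HalfEdges) {y j0} → N y j0 ∉S S → ∃ λ c → FreeAt S h y c
  freeColour {S} h {y} {j0} out = c , free
    where
    j1 j2 : Fin 3
    j1 = next j0
    j2 = third j0 j1
    c : Col
    c = third (h y (N y j1)) (h y (N y j2))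
    free : FreeAt S h y c
    free {z} z∈S y~z e with slotOf y~z ≟ j1
    ... | yes i≡j1 = third-≢₁ _ _ (trans (sym e) (trans (atSlot h y~z) (cong (λ i → h y (N y i)) i≡j1)))
    ... | no  i≢j1 = third-≢₂ _ _ (trans (sym e) (trans (atSlot h y~z) (cong (λ i → h y (N y i)) i≡j2)))
      where
      i≡j2 : slotOf y~z ≡ j2
      i≡j2 = third-unique (λ e′ → next-≢ j0 (sym e′)) (slot≢outside out z∈S y~z) i≢j1

  freeColourAvoiding : ∀ {S : Vertices} (h : HalfEdges) {y j0 j0′} → j0 ≢ j0′ → N y j0 ∉S S → N y j0′ ∉S S →
                       ∀ c0 → ∃ λ c → c ≢ c0 × FreeAt S h y c
  freeColourAvoiding {S} h {y} {j0} {j0′} j0≢j0′ out out′ c0 = c , third-≢₁ c0 _ , free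
    where
    j2 : Fin 3
    j2 = third j0 j0′
    c : Col
    c = third c0 (h y (N y j2))
    free : FreeAt S h y c
    free {z} z∈S y~z e = third-≢₂ c0 _ (trans (sym e) (trans (atSlot h y~z) (cong (λ i → h y (N y i)) i≡j2)))
      where
      i≡j2 : slotOf y~z ≡ j2
      i≡j2 = third-unique j0≢j0′ (slot≢outside out z∈S y~z) (slot≢outside out′ z∈S y~z)

  Targets : Set
  Targets = Fin 3 → Maybe (Fin n)

  isTarget? : ∀ (T : Targets) y → Dec (∃ λ s → T s ≡ just y)
  isTarget? T y = any? (λ s → ≡-decMaybe _≟_ (T s) (just y))

  record ValidTargets (S : Vertices) (T : Targets) : Set where
    field
      target∈S    : ∀ {s t} → T s ≡ just t → t ∈S S
      deficient   : ∀ {s t} → T s ≡ just t → Deficient S t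
      slot-unique : ∀ {s s′ t} → T s ≡ just t → T s′ ≡ just t → s ≡ s′

  -- Reserving
  -- these colours is what later allows a vertex whose three neighbours are
  -- all coloured to be added.
  record GoodOn (S : Vertices) (T : Targets) : Set where
    field
      h           : HalfEdges
      f           : Fin 3 → Col
      f-injective : Injective _≡_ _≡_ f
      proper      : ProperOn S h
      noBadCycle  : NoBadCycleIn S h
      reserved    : ∀ {s t} → T s ≡ just t → FreeAt S h t (f s)

  module AddVertex {S : Vertices} {T : Targets} (valid : ValidTargets S T) {v : Fin n} (v∈S : v ∈S S)
                   {T′ : Targets} (r : GoodOn (S - v) T′) where
    open ValidTargets valid
    open GoodOn r

    Incoming : Fin n → Col → Set
    Incoming y c = FreeAt (S - v) h y c × (∀ {s} → T s ≡ just y → c ≢ f s)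

    -- Removing v leaves a slot of y outside S - v.  If y is a target, its
    -- deficiency gives a second one, so even its reserved colour can be avoided.
    incomingAt : ∀ {y} → y ∈S S → Adj G y v → ∃ (Incoming y)
    incomingAt {y} y∈S y~v with isTarget? T y
    ... | yes (s0 , Ts0≡y) =
      let (c , c≢ , free) = freeColourAvoiding h jv≢j0 v∉S-v out (f s0)
      in c , free , λ Ts≡y → subst (λ s → c ≢ f s) (slot-unique Ts0≡y Ts≡y) c≢
      where
      jv : Fin 3
      jv = slotOf y~v
      j0 : Fin 3
      j0 = proj₁ (deficient Ts0≡y)
      v∉S-v : N y jv ∉S (S - v)
      v∉S-v v∈ = remove-≢ v∈ (N-slotOf y~v)
      out : N y j0 ∉S (S - v)
      out N∈ = proj₂ (deficient Ts0≡y) (remove-⊆ N∈)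
      jv≢j0 : jv ≢ j0
      jv≢j0 e = proj₂ (deficient Ts0≡y) (subst (_∈S S) (trans (sym (N-slotOf y~v)) (cong (N y) e)) v∈S)
    ... | no notTarget =
      let (c , free) = freeColour h (λ v∈ → remove-≢ v∈ (N-slotOf y~v))
      in c , free , λ {s} Ts≡y → ⊥-elim (notTarget (s , Ts≡y))

    IncomingColours : (Fin 3 → Col) → Set
    IncomingColours q = ∀ i → N v i ∈S S → Incoming (N v i) (q i)

    incoming : Σ (Fin 3 → Col) IncomingColours
    incoming = (λ i → proj₁ (choice i)) , (λ i → proj₂ (choice i))
      where
      choice : ∀ i → ∃ λ c → N v i ∈S S → Incoming (N v i) c
      choice i with N v i ∈? S
      ... | yes y∈S = let (c , ok) = incomingAt y∈S (adj-sym (N-adj v i)) in c , λ _ → ok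
      ... | no  y∉S = zero , λ y∈S → ⊥-elim (y∉S y∈S)

    incomingWith : ∀ i0 c0 → Incoming (N v i0) c0 →
                   Σ (Fin 3 → Col) λ q → IncomingColours q × q i0 ≡ c0
    incomingWith i0 c0 ok0 = (λ i → proj₁ (choice i (i ≟ i0))) , (λ i → proj₂ (choice i (i ≟ i0))) ,
                             prescribed (i0 ≟ i0)
      where
      choice : ∀ i → Dec (i ≡ i0) → ∃ λ c → N v i ∈S S → Incoming (N v i) c
      choice i (yes refl) = c0 , λ _ → ok0
      choice i (no _)     = proj₁ incoming i , proj₂ incoming i
      prescribed : (d : Dec (i0 ≡ i0)) → proj₁ (choice i0 d) ≡ c0
      prescribed (yes refl) = refl
      prescribed (no ne)    = ⊥-elim (ne refl)

    addVertex : ∀ (q σ : Fin 3 → Col) → IncomingColours q → LocalRule (Into S v) q σ →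
                (∀ {s t} → T s ≡ just t → t ≢ v → T′ s ≡ just t) →
                (∀ {s} → T s ≡ just v → ∀ i → N v i ∈S S → σ i ≢ f s) →
                GoodOn S T
    addVertex q σ q-ok rule kept σ-avoids = record
      { h = h′ ; f = f ; f-injective = f-injective
      ; proper = extend-proper proper ; noBadCycle = extend-noBadCycle proper noBadCycle
      ; reserved = reserved′ }
      where
      ok : Extendable S v h q σ
      ok = record { q-free = λ i y∈S → proj₁ (q-ok i y∈S) ; rule = rule }
      open Extension v∈S ok

      reserved′ : ∀ {s t} → T s ≡ just t → FreeAt S h′ t (f s)
      reserved′ {s} {t} Ts≡t = byCases (t ≟ v)
        where
        byCases : Dec (t ≡ v) → FreeAt S h′ t (f s)
        byCases (yes refl) = extend-freeNew (σ-avoids Ts≡t)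
        byCases (no t≢v)   = extend-freeOld t≢v (reserved (kept Ts≡t t≢v)) qAvoids
          where
          qAvoids : ∀ i → N v i ≡ t → q i ≢ f s
          qAvoids i refl = proj₂ (q-ok i (target∈S Ts≡t)) Ts≡t

  retarget : Targets → Fin 3 → Maybe (Fin n) → Targets
  retarget T s m s′ with s′ ≟ s
  ... | yes _ = m
  ... | no  _ = T s′

  retarget-same : ∀ T s m → retarget T s m s ≡ m
  retarget-same T s m with s ≟ s
  ... | yes _ = refl
  ... | no ne = ⊥-elim (ne refl)

  retarget-other : ∀ T s m {s′} → s′ ≢ s → retarget T s m s′ ≡ T s′
  retarget-other T s m {s′} s′≢s with s′ ≟ s
  ... | yes e = ⊥-elim (s′≢s e)
  ... | no  _ = refl

  otherSlot : ∀ {T : Targets} {s s′ a t} → T s ≡ just a → T s′ ≡ just t → t ≢ a → s′ ≢ s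
  otherSlot Ts≡a Ts′≡t t≢a refl = t≢a (just-injective (trans (sym Ts′≡t) Ts≡a))

  deficient-remove : ∀ {S v t} → Deficient S t → Deficient (S - v) t
  deficient-remove (j , out) = j , λ N∈ → out (remove-⊆ N∈)

  valid-removeOther : ∀ {S T v} → ValidTargets S T → (∀ {s} → T s ≢ just v) → ValidTargets (S - v) T
  valid-removeOther {T = T} valid notTarget = record
    { target∈S    = λ {s} Ts≡t → ∈-remove (target∈S Ts≡t) (λ { refl → notTarget Ts≡t })
    ; deficient   = λ Ts≡t → deficient-remove (deficient Ts≡t)
    ; slot-unique = slot-unique }
    where open ValidTargets valid

  valid-removeTarget : ∀ {S T s a} → ValidTargets S T → T s ≡ just a → ∀ m →
    (∀ {x} → m ≡ just x → x ∈S (S - a) × Deficient (S - a) x × (∀ {s′} → T s′ ≢ just x)) →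
    ValidTargets (S - a) (retarget T s m)
  valid-removeTarget {S} {T} {s} {a} valid Ts≡a m newOK = record
    { target∈S    = λ {s′} e → proj₁ (classify {s′} e)
    ; deficient   = λ {s′} e → proj₁ (proj₂ (classify {s′} e))
    ; slot-unique = unique }
    where
    open ValidTargets valid
    T′ : Targets
    T′ = retarget T s m

    old : ∀ {s′ t} → s′ ≢ s → T′ s′ ≡ just t → T s′ ≡ just t × t ≢ a
    old {s′} {t} s′≢s e = Ts′≡t , λ { refl → s′≢s (slot-unique Ts′≡t Ts≡a) }
      where
      Ts′≡t : T s′ ≡ just t
      Ts′≡t = trans (sym (retarget-other T s m s′≢s)) e

    classify : ∀ {s′ t} → T′ s′ ≡ just t → t ∈S (S - a) × Deficient (S - a) t × (s′ ≡ s ⊎ T s′ ≡ just t)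
    classify {s′} {t} e = byCases (s′ ≟ s)
      where
      byCases : Dec (s′ ≡ s) → t ∈S (S - a) × Deficient (S - a) t × (s′ ≡ s ⊎ T s′ ≡ just t)
      byCases (yes refl) = let (t∈ , def , _) = newOK (trans (sym (retarget-same T s m)) e) in t∈ , def , inj₁ refl
      byCases (no s′≢s)  = let (Ts′≡t , t≢a) = old s′≢s e in
                           ∈-remove (target∈S Ts′≡t) t≢a , deficient-remove (deficient Ts′≡t) , inj₂ Ts′≡t

    new≢old : ∀ {s′ s″ t} → T′ s′ ≡ just t → s′ ≡ s → T s″ ≡ just t → ⊥
    new≢old e refl Ts″≡t = proj₂ (proj₂ (newOK (trans (sym (retarget-same T s m)) e))) Ts″≡t

    unique : ∀ {s₁ s₂ t} → T′ s₁ ≡ just t → T′ s₂ ≡ just t → s₁ ≡ s₂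
    unique {s₁} {s₂} e₁ e₂ with proj₂ (proj₂ (classify {s₁} e₁)) | proj₂ (proj₂ (classify {s₂} e₂))
    ... | inj₁ refl | inj₁ refl = refl
    ... | inj₁ s₁≡s | inj₂ T₂   = ⊥-elim (new≢old e₁ s₁≡s T₂)
    ... | inj₂ T₁   | inj₁ s₂≡s = ⊥-elim (new≢old e₂ s₂≡s T₁)
    ... | inj₂ T₁   | inj₂ T₂   = slot-unique T₁ T₂

  retarget-keeps : ∀ {T : Targets} {s a} m → T s ≡ just a → ∀ {s′ t} → T s′ ≡ just t → t ≢ a →
                   retarget T s m s′ ≡ just t
  retarget-keeps {T} {s} m Ts≡a Ts′≡t t≢a = trans (retarget-other T s m (otherSlot Ts≡a Ts′≡t t≢a)) Ts′≡t

  ColourWithout : Vertices → Fin n → Set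
  ColourWithout S v = ∀ T′ → ValidTargets (S - v) T′ → GoodOn (S - v) T′

  -- (1) A deficient vertex v that is no target: keep the targets.  As a slot
  -- of v leaves S, a local rule exists whatever the incoming colours.
  addSpare : ∀ {S T v} → ValidTargets S T → v ∈S S → Deficient S v → (∀ {s} → T s ≢ just v) →
             ColourWithout S v → GoodOn S T
  addSpare {S} {T} {v} valid v∈S (j0 , out) notTarget colourRest =
    addVertex q σ q-ok rule (λ Ts≡t _ → Ts≡t) (λ Ts≡v → ⊥-elim (notTarget Ts≡v))
    where
    open AddVertex valid v∈S (colourRest T (valid-removeOther valid notTarget))
    q : Fin 3 → Col
    q = proj₁ incoming
    q-ok : IncomingColours q
    q-ok = proj₂ incoming
    σ : Fin 3 → Col
    σ = proj₁ (twoColouredSlots {A = Into S v} out (next-≢ j0) q)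
    rule : LocalRule (Into S v) q σ
    rule = proj₁ (proj₂ (twoColouredSlots {A = Into S v} out (next-≢ j0) q))

  -- (2) A target a (slot s) with a neighbour x = N a i0 ∈ S that is no
  -- target: x takes over slot s.  Its reserved colour f s goes on x→a, and
  -- a local rule avoiding q i0 = f s at a keeps f s free at a.
  passTarget : ∀ {S T s a i0} → ValidTargets S T → T s ≡ just a → N a i0 ∈S S →
               (∀ {s′} → T s′ ≢ just (N a i0)) → ColourWithout S a → GoodOn S T
  passTarget {S} {T} {s} {a} {i0} valid Ts≡a x∈S notTarget colourRest =
    addVertex q σ q-ok rule (λ {s′} → retarget-keeps {T} (just x) Ts≡a {s′}) σ-avoids
    where
    open ValidTargets valid
    x : Fin n
    x = N a i0
    x~a : Adj G x a
    x~a = adj-sym (N-adj a i0)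
    x-new : ∀ {y} → just x ≡ just y → y ∈S (S - a) × Deficient (S - a) y × (∀ {s′} → T s′ ≢ just y)
    x-new refl = ∈-remove x∈S (N-≢ a i0) , (slotOf x~a , λ a∈ → remove-≢ a∈ (N-slotOf x~a)) , notTarget
    r : GoodOn (S - a) (retarget T s (just x))
    r = colourRest (retarget T s (just x)) (valid-removeTarget valid Ts≡a (just x) x-new)
    open GoodOn r using (f; reserved)
    open AddVertex valid (target∈S Ts≡a) r

    incoming-x : Incoming x (f s)
    incoming-x = reserved (retarget-same T s (just x)) , λ Ts′≡x → ⊥-elim (notTarget Ts′≡x)
    q : Fin 3 → Col
    q = proj₁ (incomingWith i0 (f s) incoming-x)
    q-ok : IncomingColours q
    q-ok = proj₁ (proj₂ (incomingWith i0 (f s) incoming-x))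
    qi0≡fs : q i0 ≡ f s
    qi0≡fs = proj₂ (proj₂ (incomingWith i0 (f s) incoming-x))

    j0 : Fin 3
    j0 = proj₁ (deficient Ts≡a)
    out : N a j0 ∉S S
    out = proj₂ (deficient Ts≡a)
    i0≢j0 : i0 ≢ j0
    i0≢j0 refl = out x∈S
    local : Σ (Fin 3 → Col) λ σ → LocalRule (Into S a) q σ × (∀ {i} → Into S a i → σ i ≢ q i0)
    local = twoColouredSlots out i0≢j0 q
    σ : Fin 3 → Col
    σ = proj₁ local
    rule : LocalRule (Into S a) q σ
    rule = proj₁ (proj₂ local)
    σ-avoids : ∀ {s′} → T s′ ≡ just a → ∀ i → Into S a i → σ i ≢ f s′
    σ-avoids Ts′≡a i into = subst (λ s″ → σ i ≢ f s″) (slot-unique Ts≡a Ts′≡a)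
                                  (subst (σ i ≢_) qi0≡fs (proj₂ (proj₂ local) into))

  Closed : Vertices → Targets → Set
  Closed S T = ∀ {s t} → T s ≡ just t → ∀ i → N t i ∈S S → ∃ λ s′ → T s′ ≡ just (N t i)

  lastTarget : ∀ {T : Targets} {s s₁ s₂ s₃ a y y′ z} →
               T s ≡ just a → T s₁ ≡ just y → T s₂ ≡ just y′ → y ≢ a → y′ ≢ a → y′ ≢ y →
               T s₃ ≡ just z → z ≢ a → z ≢ y → z ≡ y′
  lastTarget {T} {s} {s₁} {s₂} {s₃} Ta Ty Ty′ y≢a y′≢a y′≢y Tz z≢a z≢y =
    just-injective (trans (sym Tz) (trans (cong T (trans s₃≡ (sym s₂≡))) Ty′))
    where
    s≢s₁ : s ≢ s₁
    s≢s₁ e = otherSlot Ta Ty y≢a (sym e)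
    s₃≡ : s₃ ≡ third s s₁
    s₃≡ = third-unique s≢s₁ (otherSlot Ta Tz z≢a) (otherSlot Ty Tz z≢y)
    s₂≡ : s₂ ≡ third s s₁
    s₂≡ = third-unique s≢s₁ (otherSlot Ta Ty′ y′≢a) (otherSlot Ty Ty′ y′≢y)

  -- For closed targets, with the target a removed and its neighbours b, c
  -- in S: a colour used at b is used on b→c (c being the only target b can
  -- see besides a), and is then free at c, whose only such neighbour is b.
  freeAtOneOf : ∀ {S T s a} {h : HalfEdges} → T s ≡ just a → ValidTargets S T → Closed S T →
                ProperOn (S - a) h → ∀ {j1 j2} → j1 ≢ j2 → N a j1 ∈S S → N a j2 ∈S S → ∀ c →
                FreeAt (S - a) h (N a j1) c ⊎ FreeAt (S - a) h (N a j2) c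
  freeAtOneOf {S} {T} {s} {a} {h} Ts≡a valid closed proper {j1} {j2} j1≢j2 b∈S c∈S col
    with any? (λ j → (N (N a j1) j ∈? (S - a)) ×-dec (h (N a j1) (N (N a j1) j) ≟ col))
  ... | no unused = inj₁ λ {z} z∈ b~z e →
          unused (slotOf b~z , subst (_∈S (S - a)) (sym (N-slotOf b~z)) z∈ , trans (sym (atSlot h b~z)) e)
  ... | yes (jb , z∈ , used) = inj₂ freeC
    where
    open ProperOn proper
    b c : Fin n
    b = N a j1
    c = N a j2
    b≢a : b ≢ a
    b≢a = N-≢ a j1
    c≢a : c ≢ a
    c≢a = N-≢ a j2
    c≢b : c ≢ b
    c≢b e = j1≢j2 (sym (N-injective a e))
    Tb : ∃ λ sb → T sb ≡ just b
    Tb = closed Ts≡a j1 b∈S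
    Tc : ∃ λ sc → T sc ≡ just c
    Tc = closed Ts≡a j2 c∈S

    targetNeighbour : ∀ {y sy i} → T sy ≡ just y → N y i ∈S (S - a) → ∃ λ s′ → T s′ ≡ just (N y i)
    targetNeighbour Ty N∈ = closed Ty _ (remove-⊆ N∈)
    isC : ∀ {s₃ z} → T s₃ ≡ just z → z ≢ a → z ≢ b → z ≡ c
    isC = lastTarget {T = T} Ts≡a (proj₂ Tb) (proj₂ Tc) b≢a c≢a c≢b
    isB : ∀ {s₃ z} → T s₃ ≡ just z → z ≢ a → z ≢ c → z ≡ b
    isB = lastTarget {T = T} Ts≡a (proj₂ Tc) (proj₂ Tb) c≢a b≢a (λ e → c≢b (sym e))

    Nbjb≡c : N b jb ≡ c
    Nbjb≡c = isC (proj₂ (targetNeighbour (proj₂ Tb) z∈)) (remove-≢ z∈) (N-≢ b jb)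
    b~c : Adj G b c
    b~c = subst (Adj G b) Nbjb≡c (N-adj b jb)
    hbc≡col : h b c ≡ col
    hbc≡col = subst (λ w → h b w ≡ col) Nbjb≡c used

    freeC : FreeAt (S - a) h c col
    freeC {z} z∈ c~z e = atEdge (∈-remove b∈S b≢a) (∈-remove c∈S c≢a) b~c (trans hbc≡col (sym hcb≡col))
      where
      Nc≡z : N c (slotOf c~z) ≡ z
      Nc≡z = N-slotOf c~z
      z≡b : z ≡ b
      z≡b = isB (subst (λ w → T (proj₁ Tz) ≡ just w) Nc≡z (proj₂ Tz)) (remove-≢ z∈) (λ e′ → adj-≢ c~z (sym e′))
        where
        Tz : ∃ λ sz → T sz ≡ just (N c (slotOf c~z))
        Tz = targetNeighbour (proj₂ Tc) (subst (_∈S (S - a)) (sym Nc≡z) z∈)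
      hcb≡col : h c b ≡ col
      hcb≡col = subst (λ w → h c w ≡ col) z≡b e

  -- (3) The targets are closed and a is the target of slot s: a gives up its
  -- reservation in S - a, and f s is kept free at a when a is added back.
  -- If a second slot of a leaves S, one local rule does this directly;
  -- otherwise f s is free at one of the two neighbours b, c of a in S, may be
  -- prescribed on the half-edge from there to a, and is then avoided at a.
  dropTarget : ∀ {S T s a} → ValidTargets S T → T s ≡ just a → Closed S T →
               ColourWithout S a → GoodOn S T
  dropTarget {S} {T} {s} {a} valid Ts≡a closed colourRest = byNeighbours (N a j1 ∈? S) (N a j2 ∈? S)
    where
    open ValidTargets valid
    r : GoodOn (S - a) (retarget T s nothing)
    r = colourRest (retarget T s nothing) (valid-removeTarget valid Ts≡a nothing (λ ()))
    open GoodOn r using (h; f; f-injective; proper)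
    open AddVertex valid (target∈S Ts≡a) r

    j0 j1 j2 : Fin 3
    j0 = proj₁ (deficient Ts≡a)
    j1 = next j0
    j2 = third j0 j1
    out : N a j0 ∉S S
    out = proj₂ (deficient Ts≡a)

    finish : ∀ q σ → IncomingColours q → LocalRule (Into S a) q σ →
             (∀ {i} → Into S a i → σ i ≢ f s) → GoodOn S T
    finish q σ q-ok rule avoid = addVertex q σ q-ok rule (λ {s′} → retarget-keeps {T} nothing Ts≡a {s′})
      (λ Ts′≡a i into → subst (λ s″ → σ i ≢ f s″) (slot-unique Ts≡a Ts′≡a) (avoid into))

    viaTwoOutside : ∀ {jX} → N a jX ∉S S → j0 ≢ jX → GoodOn S T
    viaTwoOutside outX j0≢jX = finish q (proj₁ local) (proj₂ incoming) (proj₁ (proj₂ local)) (proj₂ (proj₂ local))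
      where
      q : Fin 3 → Col
      q = proj₁ incoming
      local : Σ (Fin 3 → Col) λ σ → LocalRule (Into S a) q σ × (∀ {i} → Into S a i → σ i ≢ f s)
      local = oneColouredSlot out outX j0≢jX q (f s)

    viaFreeNeighbour : ∀ {j} → j ≢ j0 → FreeAt (S - a) h (N a j) (f s) → GoodOn S T
    viaFreeNeighbour {j} j≢j0 free = finish q σ q-ok (proj₁ (proj₂ local)) avoid
      where
      notReserved : ∀ {s′} → T s′ ≡ just (N a j) → f s ≢ f s′
      notReserved Ts′≡y e = otherSlot Ts≡a Ts′≡y (N-≢ a j) (sym (f-injective e))
      prescribed : Σ (Fin 3 → Col) λ q → IncomingColours q × q j ≡ f s
      prescribed = incomingWith j (f s) (free , notReserved)
      q : Fin 3 → Col
      q = proj₁ prescribed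
      q-ok : IncomingColours q
      q-ok = proj₁ (proj₂ prescribed)
      local : Σ (Fin 3 → Col) λ σ → LocalRule (Into S a) q σ × (∀ {i} → Into S a i → σ i ≢ q j)
      local = twoColouredSlots out j≢j0 q
      σ : Fin 3 → Col
      σ = proj₁ local
      avoid : ∀ {i} → Into S a i → σ i ≢ f s
      avoid {i} into = subst (σ i ≢_) (proj₂ (proj₂ prescribed)) (proj₂ (proj₂ local) into)

    byNeighbours : Dec (N a j1 ∈S S) → Dec (N a j2 ∈S S) → GoodOn S T
    byNeighbours (no out1)  _          = viaTwoOutside out1 (λ e → next-≢ j0 (sym e))
    byNeighbours (yes _)    (no out2)  = viaTwoOutside out2 (λ e → third-≢₁ j0 j1 (sym e))
    byNeighbours (yes b∈S)  (yes c∈S)  with freeAtOneOf {T = T} Ts≡a valid closed proper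
                                              (λ e → third-≢₂ j0 j1 (sym e)) b∈S c∈S (f s)
    ... | inj₁ freeB = viaFreeNeighbour (next-≢ j0) freeB
    ... | inj₂ freeC = viaFreeNeighbour (third-≢₁ j0 j1) freeC

  -- (4) No targets and no deficient vertex in S: remove any v and make its
  -- three neighbours the targets of S - v.  Their reserved colours are
  -- distinct, arrive at v, and the shift rule completes the colouring.
  openUp : ∀ {S T v} → ValidTargets S T → (∀ s → T s ≡ nothing) → v ∈S S → (∀ i → N v i ∈S S) →
           ColourWithout S v → GoodOn S T
  openUp {S} {T} {v} valid noTargets v∈S allInside colourRest =
    addVertex f (λ i → next (f i)) q-ok (shiftRule f-injective) (λ Ts≡t → ⊥-elim (noTarget Ts≡t))
              (λ Ts≡v → ⊥-elim (noTarget Ts≡v))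
    where
    noTarget : ∀ {s t} → T s ≡ just t → ⊥
    noTarget {s} Ts≡t with trans (sym (noTargets s)) Ts≡t
    ... | ()

    neighbours : Targets
    neighbours i = just (N v i)

    valid′ : ValidTargets (S - v) neighbours
    valid′ = record
      { target∈S    = λ { {i} refl → ∈-remove (allInside i) (N-≢ v i) }
      ; deficient   = λ { {i} refl → slotOf (adj-sym (N-adj v i)) ,
                                     λ v∈ → remove-≢ v∈ (N-slotOf (adj-sym (N-adj v i))) }
      ; slot-unique = λ e₁ e₂ → N-injective v (just-injective (trans e₁ (sym e₂))) }

    r : GoodOn (S - v) neighbours
    r = colourRest neighbours valid′
    open GoodOn r using (f; f-injective; reserved)
    open AddVertex valid v∈S r

    q-ok : IncomingColours f
    q-ok i _ = reserved refl , λ Ts≡t → ⊥-elim (noTarget Ts≡t)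

  colourEmpty : ∀ {S T} → (∀ v → v ∉S S) → ValidTargets S T → GoodOn S T
  colourEmpty none valid = record
    { h = λ _ _ → zero ; f = λ s → s ; f-injective = λ e → e
    ; proper = record { atVertex = λ x∈S _ _ _ _ _ → ⊥-elim (none _ x∈S)
                      ; atEdge   = λ x∈S _ _ → ⊥-elim (none _ x∈S) }
    ; noBadCycle = λ C inS _ → none _ (inS zero)
    ; reserved = λ Ts≡t → ⊥-elim (none _ (ValidTargets.target∈S valid Ts≡t)) }

  data Situation (S : Vertices) (T : Targets) : Set where
    empty      : (∀ v → v ∉S S) → Situation S T
    spare      : ∀ {v} → v ∈S S → Deficient S v → (∀ {s} → T s ≢ just v) → Situation S T
    passable   : ∀ {s a i0} → T s ≡ just a → N a i0 ∈S S → (∀ {s′} → T s′ ≢ just (N a i0)) →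
                 Situation S T
    closed     : ∀ {s a} → T s ≡ just a → Closed S T → Situation S T
    untargeted : ∀ {v} → (∀ s → T s ≡ nothing) → v ∈S S → (∀ i → N v i ∈S S) → Situation S T

  anyTarget? : ∀ (T : Targets) {P : Fin n → Set} → (∀ a → Dec (P a)) →
               Dec (∃ λ s → ∃ λ a → T s ≡ just a × P a)
  anyTarget? T {P} P? = any? (λ s → inSlot (T s))
    where
    inSlot : (m : Maybe (Fin n)) → Dec (∃ λ a → m ≡ just a × P a)
    inSlot nothing = no λ { (_ , () , _) }
    inSlot (just a) with P? a
    ... | yes p  = yes (a , refl , p)
    ... | no  ¬p = no λ { (_ , refl , p) → ¬p p }

  -- The cases are tried in order: targets are closed when no target is
  -- passable, and without any target a vertex with all neighbours in S
  -- exists unless some vertex is spare.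
  situation : ∀ S T → Situation S T
  situation S T with any? (_∈? S)
  ... | no none = empty λ v v∈S → none (v , v∈S)
  ... | yes (v0 , v0∈S) with any? spare?
    where
    spare? : ∀ v → Dec (v ∈S S × Deficient S v × ¬ ∃ λ s → T s ≡ just v)
    spare? v = (v ∈? S) ×-dec (any? (λ j → ¬? (N v j ∈? S)) ×-dec ¬? (isTarget? T v))
  ...   | yes (v , v∈S , def , notTarget) = spare v∈S def λ {s} Ts≡v → notTarget (s , Ts≡v)
  ...   | no noSpare with anyTarget? T passable?
    where
    passable? : ∀ a → Dec (∃ λ i0 → N a i0 ∈S S × ¬ ∃ λ s′ → T s′ ≡ just (N a i0))
    passable? a = any? (λ i0 → (N a i0 ∈? S) ×-dec ¬? (isTarget? T (N a i0)))
  ...     | yes (s , a , Ts≡a , i0 , x∈S , notTarget) = passable Ts≡a x∈S λ {s′} e → notTarget (s′ , e)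
  ...     | no noPassable with anyTarget? T {P = λ _ → Unit} (λ _ → yes tt)
  ...       | yes (s , a , Ts≡a , _) = closed Ts≡a isClosed
    where
    isClosed : Closed S T
    isClosed {s₁} {t} Ts₁≡t i N∈S with isTarget? T (N t i)
    ... | yes target = target
    ... | no  notTarget = ⊥-elim (noPassable (s₁ , t , Ts₁≡t , i , N∈S , notTarget))
  ...       | no noTarget = untargeted noTargets v0∈S allInside
    where
    noTargets : ∀ s → T s ≡ nothing
    noTargets s with T s in e
    ... | nothing = refl
    ... | just a  = ⊥-elim (noTarget (s , a , e , tt))
    allInside : ∀ i → N v0 i ∈S S
    allInside i with N v0 i ∈? S
    ... | yes N∈S = N∈S
    ... | no  out = ⊥-elim (noSpare (v0 , v0∈S , (i , out) , λ (s , Ts≡v0) → noTarget (s , v0 , Ts≡v0 , tt)))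

  colour : ∀ k S → ∣ S ∣ ≤ k → ∀ T → ValidTargets S T → GoodOn S T
  colour zero S size T valid = colourEmpty (λ v v∈S → ℕₚ.n≮0 (ℕₚ.<-≤-trans (x∈p⇒∣p-x∣<∣p∣ v∈S) size)) valid
  colour (suc k) S size T valid = byCases (situation S T)
    where
    open ValidTargets valid
    colourWithout : ∀ {v} → v ∈S S → ColourWithout S v
    colourWithout {v} v∈S = colour k (S - v) (ℕₚ.≤-pred (ℕₚ.≤-trans (x∈p⇒∣p-x∣<∣p∣ v∈S) size))

    byCases : Situation S T → GoodOn S T
    byCases (empty none)                     = colourEmpty none valid
    byCases (spare v∈S def notTarget)        = addSpare valid v∈S def notTarget (colourWithout v∈S)
    byCases (passable Ts≡a x∈S notTarget)    = passTarget valid Ts≡a x∈S notTarget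
                                                 (colourWithout (target∈S Ts≡a))
    byCases (closed Ts≡a isClosed)           = dropTarget valid Ts≡a isClosed (colourWithout (target∈S Ts≡a))
    byCases (untargeted noTargets v∈S allIn) = openUp valid noTargets v∈S allIn (colourWithout v∈S)

  goodColouring : ∃ λ h → GoodHalfEdgeColoring G h
  goodColouring = h , ((λ u v w → atVertex ∈⊤ ∈⊤ ∈⊤) , (λ u v → atEdge ∈⊤ ∈⊤)) , (λ C → noBadCycle C (λ _ → ∈⊤))
    where
    noTargets : ValidTargets ⊤ (λ _ → nothing)
    noTargets = record { target∈S = λ () ; deficient = λ () ; slot-unique = λ () }
    open GoodOn (colour ∣ ⊤ {n} ∣ ⊤ ℕₚ.≤-refl (λ _ → nothing) noTargets)
    open ProperOn proper

lemma4p1 : ∀ (n : ℕ) (G : Graph n) → Cubic G →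
    ∃ λ (h : HalfEdgeAssignment n) → GoodHalfEdgeColoring G h
lemma4p1 n G cubic = Construction.goodColouring G (neighbourSlots G cubic)
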